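{- Let $G=\{1,\dots,\sqrt{n}\}\times\{1,\dots,\sqrt{n}\}$ be the integer grid of size $\sqrt{n}\times\sqrt{n}$ (with $\sqrt n$ a positive integer). Then every segment $pq$ with $p,q\in G$ is an edge of at most $O(\sqrt{n}\log n)$ interior-empty triangles, where the constant in the $O$-notation is independent of $n$ and of the segment.
   Context: An interior-empty triangle incident to $pq$ is a (possibly degenerate) triangle with vertices $p,q,r$ for some $r\in G$ whose interior contains no point of $G$. -}

module Defs where

open import Data.Nat using (ℕ)
open import Data.Integer using (ℤ; +_; _+_; _-_; _*_; _<_; _≤_)
open import Data.Product using (_×_; _,_)
open import Data.Sum using (_⊎_)
open import Relation.Nullary using (¬_)

Point : Set
Point = ℤ × ℤ

-- Membership in the grid G = {1,…,m} × {1,…,m}  (m = √n).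
InGrid : ℕ → Point → Set
InGrid m (x , y) = (+ 1 ≤ x × x ≤ + m) × (+ 1 ≤ y × y ≤ + m)

-- Twice the signed area of the triangle (p, q, s) (orientation determinant).
orient : Point → Point → Point → ℤ
orient (px , py) (qx , qy) (sx , sy) = (qx - px) * (sy - py) - (qy - py) * (sx - px)

-- s lies in the (open) interior of triangle pqr: strictly on the same side of
-- all three directed edges.  For a degenerate (collinear) triangle this never
-- holds, so its interior is empty.
InInterior : Point → Point → Point → Point → Set
InInterior p q r s =
  (+ 0 < orient p q s × + 0 < orient q r s × + 0 < orient r p s)
  ⊎ (orient p q s < + 0 × orient q r s < + 0 × orient r p s < + 0)

InteriorEmpty : ℕ → Point → Point → Point → Set
InteriorEmpty m p q r = ∀ s → InGrid m s → ¬ InInterior p q r s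

-- Write q − p = g·v with v primitive and complete v, by Bézout, to a basis (v, w) of ℤ² with
-- cross v w = 1. A grid point r on the left of pq is then p + x·v + k·w with k = cross v (r − p) > 0,
-- and shearing w to u = w + ⌊x/k⌋·v gives r = p + t·v + k·u with 0 ≤ t < k. The lattice point
-- p + v + u lies strictly inside pqr unless t = 0, or t = 1 and g = 1, and being inside a grid
-- triangle it is a grid point. So the apex of an interior-empty triangle on the left of pq is
-- b + k·u with b ∈ {p, q} and cross v u = 1. That equation recovers u from one coordinate c of u,
-- and k·∣c∣ ≤ m = √n, so these apexes are counted by the lattice points (k, c) under the hyperbola
-- k·∣c∣ ≤ m, of which there are O(m log m) (group the k dyadically). Collinear apexes lie on a line,
-- at most m of them, and the right side of pq is the left side of qp.
module Submission where

open import Defs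

module Counting where

  open import Data.Nat using (ℕ; zero; suc; z≤n; s≤s; _≤_; _+_)
  open import Data.Nat.Properties using (≤-trans; ≤-refl; ≤-pred; +-suc)
  open import Data.Empty using (⊥-elim)
  open import Data.List using ([]; _∷_; length)
  open import Data.List.Membership.Propositional using (_∈_)
  open import Data.List.Relation.Unary.All as All using (All; []; _∷_)
  open import Data.List.Relation.Unary.AllPairs using ([]; _∷_)
  open import Data.List.Relation.Unary.Any using (here; there)
  open import Data.List.Relation.Unary.Unique.Propositional using (Unique)
  open import Data.Product using (∃-syntax; _×_; _,_; proj₁; proj₂)
  open import Data.Sum using (_⊎_; inj₁; inj₂)
  open import Relation.Binary.PropositionalEquality
  open import Relation.Nullary using (¬_)

  Bounded : {A : Set} → (A → Set) → ℕ → Set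
  Bounded P n = ∀ xs → Unique xs → All P xs → length xs ≤ n

  module _ {A : Set} where

    Bounded-mono : ∀ {P Q : A → Set} {n n′} → (∀ {x} → Q x → P x) → n ≤ n′ → Bounded P n → Bounded Q n′
    Bounded-mono Q⇒P n≤n′ bounded xs unique all = ≤-trans (bounded xs unique (All.map Q⇒P all)) n≤n′

    Bounded-∅ : ∀ {P : A → Set} → (∀ {x} → ¬ P x) → Bounded P 0
    Bounded-∅ ¬P []      _ _        = z≤n
    Bounded-∅ ¬P (_ ∷ _) _ (px ∷ _) = ⊥-elim (¬P px)

    Bounded-≡ : ∀ (y : A) → Bounded (_≡ y) 1
    Bounded-≡ y []          _                _                  = z≤n
    Bounded-≡ y (_ ∷ [])    _                _                  = s≤s z≤n
    Bounded-≡ y (_ ∷ _ ∷ _) ((x≢x′ ∷ _) ∷ _) (refl ∷ refl ∷ _) = ⊥-elim (x≢x′ refl)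

    Bounded-without : ∀ {P : A → Set} {n x} → Bounded P n → P x →
      ∃[ n₀ ] n ≡ suc n₀ × Bounded (λ y → P y × x ≢ y) n₀
    Bounded-without {n = zero}   bounded px with () ← bounded (_ ∷ []) ([] ∷ []) (px ∷ [])
    Bounded-without {n = suc n₀} bounded px = n₀ , refl , λ xs unique all →
      ≤-pred (bounded (_ ∷ xs) (All.map proj₂ all ∷ unique) (px ∷ All.map proj₁ all))

    private
      ∪-without : ∀ {P Q : A → Set} {x y} → (P y ⊎ Q y) × x ≢ y → (P y × x ≢ y) ⊎ (Q y × x ≢ y)
      ∪-without (inj₁ py , x≢y) = inj₁ (py , x≢y)
      ∪-without (inj₂ qy , x≢y) = inj₂ (qy , x≢y)

    Bounded-∪ : ∀ {P Q : A → Set} {n n′} → Bounded P n → Bounded Q n′ → Bounded (λ x → P x ⊎ Q x) (n + n′)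
    Bounded-∪ bp bq [] _ _ = z≤n
    Bounded-∪ {P} {Q} bp bq (x ∷ xs) (x∉ ∷ unique) (inj₁ px ∷ all) with Bounded-without bp px
    ... | _ , refl , bp′ = s≤s (Bounded-∪ bp′ (Bounded-mono {P = Q} proj₁ ≤-refl bq) xs unique
                                  (All.zipWith (∪-without {P = P} {Q}) (all , x∉)))
    Bounded-∪ {P} {Q} {n} bp bq (x ∷ xs) (x∉ ∷ unique) (inj₂ qx ∷ all) with Bounded-without bq qx
    ... | n₀ , refl , bq′ = subst (suc (length xs) ≤_) (sym (+-suc n n₀))
      (s≤s (Bounded-∪ (Bounded-mono {P = P} proj₁ ≤-refl bp) bq′ xs unique
                      (All.zipWith (∪-without {P = P} {Q}) (all , x∉))))

    Bounded-∈ : ∀ ys → Bounded (_∈ ys) (length ys)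
    Bounded-∈ []       = Bounded-∅ λ ()
    Bounded-∈ (y ∷ ys) = Bounded-mono (λ { (here x≡y) → inj₁ x≡y ; (there x∈) → inj₂ x∈ }) ≤-refl
      (Bounded-∪ (Bounded-≡ y) (Bounded-∈ ys))

  Bounded-by-keys : ∀ {A B : Set} {P : A → Set} {Q : B → Set} {n} (R : A → B → Set) →
    (∀ x y k → R x k → R y k → x ≡ y) → Bounded Q n →
    (∀ {x} → P x → ∃[ k ] R x k × Q k) → Bounded P n
  Bounded-by-keys R R-injective bq keyOf [] _ _ = z≤n
  Bounded-by-keys {P = P} {Q} R R-injective bq keyOf (x ∷ xs) (x∉ ∷ unique) (px ∷ all) with keyOf px
  ... | k , rxk , qk with Bounded-without bq qk
  ...   | _ , refl , bq′ = s≤s (Bounded-by-keys R R-injective bq′ keyOf′ xs unique (All.zip (all , x∉)))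
    where
    keyOf′ : ∀ {y} → P y × x ≢ y → ∃[ k′ ] R y k′ × (Q k′ × k ≢ k′)
    keyOf′ {y} (py , x≢y) with keyOf py
    ... | k′ , ryk′ , qk′ = k′ , ryk′ , qk′ , λ { refl → x≢y (R-injective x y k rxk ryk′) }

module Hyperbola where

  open Counting
  open import Data.Nat
  open import Data.Nat.Properties
  open import Data.Nat.DivMod using (_/_; m/n*n≤m; m*n/n≡m; /-monoˡ-≤)
  open import Data.Nat.Logarithm using (⌊log₂_⌋; ⌊log₂⌋-mono-≤; ⌊log₂[2*b]⌋≡1+⌊log₂b⌋; ⌊log₂[2^n]⌋≡n)
  open import Data.Nat.Tactic.RingSolver using (solve-∀)
  open import Data.Integer as ℤ using (ℤ; -[1+_]; ∣_∣)
  open import Data.List using (List; []; _∷_; _++_; map; length; applyUpTo; upTo; cartesianProduct)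
  open import Data.List.Properties using (length-++; length-map; length-applyUpTo; length-upTo)
  open import Data.List.Membership.Propositional using (_∈_)
  open import Data.List.Membership.Propositional.Properties
    using (∈-++⁺ˡ; ∈-++⁺ʳ; ∈-map⁺; ∈-applyUpTo⁺; ∈-upTo⁺; ∈-cartesianProduct⁺)
  open import Data.Product using (∃-syntax; _×_; _,_; proj₁)
  open import Data.Sum using (_⊎_; inj₁; inj₂)
  open import Function using (id)
  open import Relation.Binary.PropositionalEquality
  open import Relation.Nullary using (yes; no)

  interval : ℕ → ℕ → List ℕ
  interval lo n = applyUpTo (lo +_) n

  ∈-interval : ∀ {lo n k} → lo ≤ k → k < lo + n → k ∈ interval lo n
  ∈-interval {lo} {n} lo≤k k<lo+n = subst (_∈ interval lo n) (m+[n∸m]≡n lo≤k)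
    (∈-applyUpTo⁺ (lo +_) (+-cancelˡ-< lo _ _ (subst (_< lo + n) (sym (m+[n∸m]≡n lo≤k)) k<lo+n)))

  ball : ℕ → List ℤ
  ball n = map ℤ.+_ (upTo (suc n)) ++ map -[1+_] (upTo n)

  length-ball : ∀ n → length (ball n) ≡ suc n + n
  length-ball n = begin
    length (ball n)
      ≡⟨ length-++ (map ℤ.+_ (upTo (suc n))) ⟩
    length (map ℤ.+_ (upTo (suc n))) + length (map -[1+_] (upTo n))
      ≡⟨ cong₂ _+_ (length-map ℤ.+_ (upTo (suc n))) (length-map -[1+_] (upTo n)) ⟩
    length (upTo (suc n)) + length (upTo n)
      ≡⟨ cong₂ _+_ (length-upTo (suc n)) (length-upTo n) ⟩
    suc n + n ∎
    where open ≡-Reasoning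

  ∈-ball : ∀ {n} c → ∣ c ∣ ≤ n → c ∈ ball n
  ∈-ball (ℤ.+ k)  k≤n = ∈-++⁺ˡ (∈-map⁺ ℤ.+_ (∈-upTo⁺ (s≤s k≤n)))
  ∈-ball -[1+ k ] k<n = ∈-++⁺ʳ _ (∈-map⁺ -[1+_] (∈-upTo⁺ k<n))

  length-cartesianProduct : ∀ {A B : Set} (xs : List A) (ys : List B) →
    length (cartesianProduct xs ys) ≡ length xs * length ys
  length-cartesianProduct []       ys = refl
  length-cartesianProduct (x ∷ xs) ys = begin
    length (map (x ,_) ys ++ cartesianProduct xs ys)          ≡⟨ length-++ (map (x ,_) ys) ⟩
    length (map (x ,_) ys) + length (cartesianProduct xs ys)  ≡⟨ cong₂ _+_ (length-map (x ,_) ys)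
                                                                            (length-cartesianProduct xs ys) ⟩
    length ys + length xs * length ys                         ∎
    where open ≡-Reasoning

  UnderHyperbola : ℕ → ℕ × ℤ → Set
  UnderHyperbola m (k , c) = 1 ≤ k × k ≤ m × k * ∣ c ∣ ≤ m

  DyadicBlock : ℕ → ℕ → ℕ × ℤ → Set
  DyadicBlock m j key = UnderHyperbola m key × 2 ^ j ≤ proj₁ key × proj₁ key < 2 ^ suc j

  -- The block has at most 2ʲ values of k, and 2ʲ∣c∣ ≤ m leaves 2⌊m/2ʲ⌋ + 1 values of c.
  DyadicBlock-bounded : ∀ m j → Bounded (DyadicBlock m j) (3 * m)
  DyadicBlock-bounded m j with 2 ^ j ≤? m
  ... | no 2^j≰m = Bounded-mono id z≤n (Bounded-∅ λ { ((_ , k≤m , _) , 2^j≤k , _) → 2^j≰m (≤-trans 2^j≤k k≤m) })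
  ... | yes 2^j≤m = Bounded-mono (λ {key} → cover {key}) length≤3m (Bounded-∈ keys)
    where
    instance
      2^j≢0 : NonZero (2 ^ j)
      2^j≢0 = m^n≢0 2 j
    keys : List (ℕ × ℤ)
    keys = cartesianProduct (interval (2 ^ j) (2 ^ j)) (ball (m / 2 ^ j))
    cover : ∀ {key} → DyadicBlock m j key → key ∈ keys
    cover {k , c} ((_ , _ , k∣c∣≤m) , 2^j≤k , k<2^j⁺¹) =
      ∈-cartesianProduct⁺ (∈-interval 2^j≤k k<2^j+2^j) (∈-ball c ∣c∣≤m/2^j)
      where
      k<2^j+2^j : k < 2 ^ j + 2 ^ j
      k<2^j+2^j = subst (k <_) (cong (2 ^ j +_) (+-identityʳ (2 ^ j))) k<2^j⁺¹
      ∣c∣≤m/2^j : ∣ c ∣ ≤ m / 2 ^ j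
      ∣c∣≤m/2^j = subst (_≤ m / 2 ^ j) (m*n/n≡m ∣ c ∣ (2 ^ j)) (/-monoˡ-≤ (2 ^ j) (begin
        ∣ c ∣ * 2 ^ j  ≡⟨ *-comm ∣ c ∣ (2 ^ j) ⟩
        2 ^ j * ∣ c ∣  ≤⟨ *-monoˡ-≤ ∣ c ∣ 2^j≤k ⟩
        k * ∣ c ∣      ≤⟨ k∣c∣≤m ⟩
        m              ∎))
        where open ≤-Reasoning
    length≤3m : length keys ≤ 3 * m
    length≤3m = begin
      length keys
        ≡⟨ length-cartesianProduct (interval (2 ^ j) (2 ^ j)) (ball (m / 2 ^ j)) ⟩
      length (interval (2 ^ j) (2 ^ j)) * length (ball (m / 2 ^ j))
        ≡⟨ cong₂ _*_ (length-applyUpTo (2 ^ j +_) (2 ^ j)) (length-ball (m / 2 ^ j)) ⟩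
      2 ^ j * (suc (m / 2 ^ j) + m / 2 ^ j)
        ≡⟨ expand (2 ^ j) (m / 2 ^ j) ⟩
      2 ^ j + (m / 2 ^ j * 2 ^ j + m / 2 ^ j * 2 ^ j)
        ≤⟨ +-mono-≤ 2^j≤m (+-mono-≤ (m/n*n≤m m (2 ^ j)) (m/n*n≤m m (2 ^ j))) ⟩
      m + (m + m)
        ≡⟨ cong (λ n → m + (m + n)) (sym (+-identityʳ m)) ⟩
      3 * m ∎
      where
      open ≤-Reasoning
      expand : ∀ a b → a * (suc b + b) ≡ a + (b * a + b * a)
      expand = solve-∀

  UnderHyperbola-below : ∀ m j → Bounded (λ key → UnderHyperbola m key × proj₁ key < 2 ^ j) (j * (3 * m))
  UnderHyperbola-below m zero    = Bounded-∅ λ { ((1≤k , _) , k<1) → <⇒≱ k<1 1≤k }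
  UnderHyperbola-below m (suc j) = Bounded-mono (λ {key} → split {key}) ≤-refl
    (Bounded-∪ (DyadicBlock-bounded m j) (UnderHyperbola-below m j))
    where
    split : ∀ {key} → UnderHyperbola m key × proj₁ key < 2 ^ suc j →
      DyadicBlock m j key ⊎ (UnderHyperbola m key × proj₁ key < 2 ^ j)
    split {k , _} (key , k<2^j⁺¹) with k <? 2 ^ j
    ... | yes k<2^j = inj₂ (key , k<2^j)
    ... | no  k≮2^j = inj₁ (key , ≮⇒≥ k≮2^j , k<2^j⁺¹)

  power-of-two-above : ∀ n → ∃[ j ] n < 2 ^ j × j ≤ suc ⌊log₂ n ⌋
  power-of-two-above zero = 0 , s≤s z≤n , z≤n
  power-of-two-above (suc n) with power-of-two-above n
  ... | j , n<2^j , j≤ with suc n <? 2 ^ j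
  ...   | yes 1+n<2^j = j , 1+n<2^j , ≤-trans j≤ (s≤s (⌊log₂⌋-mono-≤ (n≤1+n n)))
  ...   | no  1+n≮2^j = suc j , 1+n<2^j⁺¹ ,
    s≤s (≤-reflexive (trans (sym (⌊log₂[2^n]⌋≡n j)) (cong ⌊log₂_⌋ (sym 1+n≡2^j))))
    where
    1+n≡2^j : suc n ≡ 2 ^ j
    1+n≡2^j = ≤-antisym n<2^j (≮⇒≥ 1+n≮2^j)
    1+n<2^j⁺¹ : suc n < 2 ^ suc j
    1+n<2^j⁺¹ = subst (_< 2 ^ suc j) (sym 1+n≡2^j) (^-monoʳ-< 2 (s≤s (s≤s z≤n)) (n<1+n j))

  UnderHyperbola-bounded : ∀ m → 2 ≤ m → Bounded (UnderHyperbola m) (⌊log₂ (m * m) ⌋ * (3 * m))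
  UnderHyperbola-bounded m 2≤m with power-of-two-above m
  ... | j , m<2^j , j≤ = Bounded-mono (λ {key} → below {key}) (*-monoˡ-≤ (3 * m) j≤log) (UnderHyperbola-below m j)
    where
    instance
      m≢0 : NonZero m
      m≢0 = >-nonZero (≤-trans (s≤s z≤n) 2≤m)
    below : ∀ {key} → UnderHyperbola m key → UnderHyperbola m key × proj₁ key < 2 ^ j
    below {_ , _} key@(_ , k≤m , _) = key , ≤-<-trans k≤m m<2^j
    j≤log : j ≤ ⌊log₂ (m * m) ⌋
    j≤log = ≤-trans j≤ (≤-trans (≤-reflexive (sym (⌊log₂[2*b]⌋≡1+⌊log₂b⌋ m))) (⌊log₂⌋-mono-≤ (*-monoˡ-≤ m 2≤m)))

module Plane where

  open import Data.Integer
    using (ℤ; +_; +[1+_]; -[1+_]; 0ℤ; 1ℤ; -1ℤ; _+_; _-_; _*_; -_; ∣_∣; _<_; _≤_; NonZero; positive; ≢-nonZero)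
  open import Data.Integer.Properties
  open import Data.Integer.Divisibility.Signed using (divides; ∣ᵤ⇒∣)
  open import Data.Integer.Tactic.RingSolver using (solve-∀)
  import Data.Nat as ℕ
  open import Data.Nat.GCD
    using (gcd; gcd-GCD; module Bézout; gcd[m,n]∣m; gcd[m,n]∣n; gcd[m,n]≡0⇒m≡0; gcd[m,n]≡0⇒n≡0)
  open import Data.Empty using (⊥-elim)
  open import Data.Product using (∃-syntax; ∃₂; _×_; _,_; proj₁; proj₂)
  open import Data.Sum as Sum using (inj₁; inj₂)
  open import Relation.Binary.PropositionalEquality
  open import Relation.Nullary using (yes; no; contradiction)
  open ≡-Reasoning

  -- The ring solver does not unfold ⊕, ⊙, cross or orient, so each vector identity below is proved
  -- coordinatewise from an integer identity stated with these definitions unfolded.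

  infixl 6 _⊕_ _⊖_
  infixr 7 _⊙_

  _⊕_ : Point → Point → Point
  (a₁ , a₂) ⊕ (b₁ , b₂) = a₁ + b₁ , a₂ + b₂

  _⊖_ : Point → Point → Point
  (a₁ , a₂) ⊖ (b₁ , b₂) = a₁ - b₁ , a₂ - b₂

  _⊙_ : ℤ → Point → Point
  k ⊙ (a₁ , a₂) = k * a₁ , k * a₂

  cross : Point → Point → ℤ
  cross (a₁ , a₂) (b₁ , b₂) = a₁ * b₂ - a₂ * b₁

  ⊕-⊖-cancel : ∀ o d → (o ⊕ d) ⊖ o ≡ d
  ⊕-⊖-cancel (o₁ , o₂) (d₁ , d₂) = cong₂ _,_ (identity o₁ d₁) (identity o₂ d₂)
    where
    identity : ∀ o d → (o + d) - o ≡ d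
    identity = solve-∀

  ⊖-⊕-cancel : ∀ o r → o ⊕ (r ⊖ o) ≡ r
  ⊖-⊕-cancel (o₁ , o₂) (r₁ , r₂) = cong₂ _,_ (identity o₁ r₁) (identity o₂ r₂)
    where
    identity : ∀ o r → o + (r - o) ≡ r
    identity = solve-∀

  ⊖-injectiveˡ : ∀ {a b} o → a ⊖ o ≡ b ⊖ o → a ≡ b
  ⊖-injectiveˡ {a} {b} o eq = trans (sym (⊖-⊕-cancel o a)) (trans (cong (o ⊕_) eq) (⊖-⊕-cancel o b))

  ⊖-≢0 : ∀ {p q} → p ≢ q → q ⊖ p ≢ (0ℤ , 0ℤ)
  ⊖-≢0 {p@(p₁ , p₂)} p≢q q⊖p≡0 =
    p≢q (sym (⊖-injectiveˡ p (trans q⊖p≡0 (cong₂ _,_ (sym (+-inverseʳ p₁)) (sym (+-inverseʳ p₂))))))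

  cross-⊙ˡ : ∀ k a b → cross (k ⊙ a) b ≡ k * cross a b
  cross-⊙ˡ k (a₁ , a₂) (b₁ , b₂) = identity k a₁ a₂ b₁ b₂
    where
    identity : ∀ k a₁ a₂ b₁ b₂ → k * a₁ * b₂ - k * a₂ * b₁ ≡ k * (a₁ * b₂ - a₂ * b₁)
    identity = solve-∀

  cross-zeroˡ : ∀ w → cross (0ℤ , 0ℤ) w ≡ 0ℤ
  cross-zeroˡ (w₁ , w₂) = identity w₁ w₂
    where
    identity : ∀ w₁ w₂ → 0ℤ * w₂ - 0ℤ * w₁ ≡ 0ℤ
    identity = solve-∀

  cross-zeroʳ : ∀ v → cross v (0ℤ , 0ℤ) ≡ 0ℤ
  cross-zeroʳ (v₁ , v₂) = identity v₁ v₂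
    where
    identity : ∀ v₁ v₂ → v₁ * 0ℤ - v₂ * 0ℤ ≡ 0ℤ
    identity = solve-∀

  unimodular⇒≢0ˡ : ∀ {v w} → cross v w ≡ 1ℤ → v ≢ (0ℤ , 0ℤ)
  unimodular⇒≢0ˡ {w = w} det refl = contradiction (trans (sym det) (cross-zeroˡ w)) λ ()

  unimodular⇒≢0ʳ : ∀ {v w} → cross v w ≡ 1ℤ → w ≢ (0ℤ , 0ℤ)
  unimodular⇒≢0ʳ {v = v} det refl = contradiction (trans (sym det) (cross-zeroʳ v)) λ ()

  cross-cyclic-sum : ∀ a b c → cross b c ⊙ a ⊕ cross c a ⊙ b ⊕ cross a b ⊙ c ≡ (0ℤ , 0ℤ)
  cross-cyclic-sum (a₁ , a₂) (b₁ , b₂) (c₁ , c₂) =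
    cong₂ _,_ (first a₁ a₂ b₁ b₂ c₁ c₂) (second a₁ a₂ b₁ b₂ c₁ c₂)
    where
    first : ∀ a₁ a₂ b₁ b₂ c₁ c₂ →
      (b₁ * c₂ - b₂ * c₁) * a₁ + (c₁ * a₂ - c₂ * a₁) * b₁ + (a₁ * b₂ - a₂ * b₁) * c₁ ≡ 0ℤ
    first = solve-∀
    second : ∀ a₁ a₂ b₁ b₂ c₁ c₂ →
      (b₁ * c₂ - b₂ * c₁) * a₂ + (c₁ * a₂ - c₂ * a₁) * b₂ + (a₁ * b₂ - a₂ * b₁) * c₂ ≡ 0ℤ
    second = solve-∀

  orient-rotate : ∀ p q r → orient p q r ≡ orient q r p
  orient-rotate (p₁ , p₂) (q₁ , q₂) (r₁ , r₂) = identity p₁ p₂ q₁ q₂ r₁ r₂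
    where
    identity : ∀ p₁ p₂ q₁ q₂ r₁ r₂ →
      (q₁ - p₁) * (r₂ - p₂) - (q₂ - p₂) * (r₁ - p₁) ≡ (r₁ - q₁) * (p₂ - q₂) - (r₂ - q₂) * (p₁ - q₁)
    identity = solve-∀

  orient-swap : ∀ p q r → orient q p r ≡ - orient p q r
  orient-swap (p₁ , p₂) (q₁ , q₂) (r₁ , r₂) = identity p₁ p₂ q₁ q₂ r₁ r₂
    where
    identity : ∀ p₁ p₂ q₁ q₂ r₁ r₂ →
      (p₁ - q₁) * (r₂ - q₂) - (p₂ - q₂) * (r₁ - q₁) ≡ - ((q₁ - p₁) * (r₂ - p₂) - (q₂ - p₂) * (r₁ - p₁))
    identity = solve-∀

  orient-from-base : ∀ {p q} k v r → q ≡ p ⊕ k ⊙ v → orient p q r ≡ k * cross v (r ⊖ p)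
  orient-from-base {p} k v r refl =
    trans (cong (λ d → cross d (r ⊖ p)) (⊕-⊖-cancel p (k ⊙ v))) (cross-⊙ˡ k v (r ⊖ p))

  -- Affine lattice frames

  linear : Point → Point → Point → Point
  linear v u (x , y) = x ⊙ v ⊕ y ⊙ u

  affine : Point → Point → Point → Point → Point
  affine o v u a = o ⊕ linear v u a

  affine-⊖ : ∀ o v u a b → affine o v u b ⊖ affine o v u a ≡ linear v u (b ⊖ a)
  affine-⊖ (o₁ , o₂) (v₁ , v₂) (u₁ , u₂) (a₁ , a₂) (b₁ , b₂) =
    cong₂ _,_ (identity o₁ v₁ u₁ a₁ a₂ b₁ b₂) (identity o₂ v₂ u₂ a₁ a₂ b₁ b₂)
    where
    identity : ∀ o v u a₁ a₂ b₁ b₂ →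
      (o + (b₁ * v + b₂ * u)) - (o + (a₁ * v + a₂ * u)) ≡ (b₁ - a₁) * v + (b₂ - a₂) * u
    identity = solve-∀

  cross-linear : ∀ v u a b → cross (linear v u a) (linear v u b) ≡ cross v u * cross a b
  cross-linear (v₁ , v₂) (u₁ , u₂) (a₁ , a₂) (b₁ , b₂) = identity v₁ v₂ u₁ u₂ a₁ a₂ b₁ b₂
    where
    identity : ∀ v₁ v₂ u₁ u₂ a₁ a₂ b₁ b₂ →
      (a₁ * v₁ + a₂ * u₁) * (b₁ * v₂ + b₂ * u₂) - (a₁ * v₂ + a₂ * u₂) * (b₁ * v₁ + b₂ * u₁)
        ≡ (v₁ * u₂ - v₂ * u₁) * (a₁ * b₂ - a₂ * b₁)
    identity = solve-∀

  orient-affine : ∀ o v u a b c →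
    orient (affine o v u a) (affine o v u b) (affine o v u c) ≡ cross v u * orient a b c
  orient-affine o v u a b c = begin
    -- orient p q r unfolds to cross (q ⊖ p) (r ⊖ p)
    cross (affine o v u b ⊖ affine o v u a) (affine o v u c ⊖ affine o v u a)
      ≡⟨ cong₂ cross (affine-⊖ o v u a b) (affine-⊖ o v u a c) ⟩
    cross (linear v u (b ⊖ a)) (linear v u (c ⊖ a))
      ≡⟨ cross-linear v u (b ⊖ a) (c ⊖ a) ⟩
    cross v u * cross (b ⊖ a) (c ⊖ a) ∎

  orient-unimodular : ∀ o v u → cross v u ≡ 1ℤ → ∀ a b c →
    orient (affine o v u a) (affine o v u b) (affine o v u c) ≡ orient a b c
  orient-unimodular o v u det a b c =
    trans (orient-affine o v u a b c) (trans (cong (_* orient a b c) det) (*-identityˡ (orient a b c)))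

  InInterior-affine : ∀ o v u a b c s → cross v u ≡ 1ℤ → InInterior a b c s →
    InInterior (affine o v u a) (affine o v u b) (affine o v u c) (affine o v u s)
  InInterior-affine o v u a b c s det = Sum.map (transport (0ℤ <_)) (transport (_< 0ℤ))
    where
    transport : (P : ℤ → Set) → P (orient a b s) × P (orient b c s) × P (orient c a s) →
      P (orient (affine o v u a) (affine o v u b) (affine o v u s)) ×
      P (orient (affine o v u b) (affine o v u c) (affine o v u s)) ×
      P (orient (affine o v u c) (affine o v u a) (affine o v u s))
    transport P (abs , bcs , cas) = preserve a b abs , preserve b c bcs , preserve c a cas
      where
      preserve : ∀ x y → P (orient x y s) → P (orient (affine o v u x) (affine o v u y) (affine o v u s))
      preserve x y = subst P (sym (orient-unimodular o v u det x y s))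

  linear-coordinates : ∀ v w d → cross v w ≡ 1ℤ → linear v w (cross d w , cross v d) ≡ d
  linear-coordinates (v₁ , v₂) (w₁ , w₂) (d₁ , d₂) det = cong₂ _,_
    (trans (first v₁ v₂ w₁ w₂ d₁ d₂) (trans (cong (_* d₁) det) (*-identityˡ d₁)))
    (trans (second v₁ v₂ w₁ w₂ d₁ d₂) (trans (cong (_* d₂) det) (*-identityˡ d₂)))
    where
    first : ∀ v₁ v₂ w₁ w₂ d₁ d₂ →
      (d₁ * w₂ - d₂ * w₁) * v₁ + (v₁ * d₂ - v₂ * d₁) * w₁ ≡ (v₁ * w₂ - v₂ * w₁) * d₁
    first = solve-∀
    second : ∀ v₁ v₂ w₁ w₂ d₁ d₂ →
      (d₁ * w₂ - d₂ * w₁) * v₂ + (v₁ * d₂ - v₂ * d₁) * w₂ ≡ (v₁ * w₂ - v₂ * w₁) * d₂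
    second = solve-∀

  affine-coordinates : ∀ o v w r → cross v w ≡ 1ℤ → affine o v w (cross (r ⊖ o) w , cross v (r ⊖ o)) ≡ r
  affine-coordinates o v w r det = trans (cong (o ⊕_) (linear-coordinates v w (r ⊖ o) det)) (⊖-⊕-cancel o r)

  affine-shear : ∀ o v w q x y → affine o v w (x , y) ≡ affine o v (q ⊙ v ⊕ w) (x - q * y , y)
  affine-shear (o₁ , o₂) (v₁ , v₂) (w₁ , w₂) q x y =
    cong₂ _,_ (identity o₁ v₁ w₁ q x y) (identity o₂ v₂ w₂ q x y)
    where
    identity : ∀ o v w q x y → o + (x * v + y * w) ≡ o + ((x - q * y) * v + y * (q * v + w))
    identity = solve-∀

  cross-shear : ∀ q v w → cross v (q ⊙ v ⊕ w) ≡ cross v w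
  cross-shear q (v₁ , v₂) (w₁ , w₂) = identity q v₁ v₂ w₁ w₂
    where
    identity : ∀ q v₁ v₂ w₁ w₂ → v₁ * (q * v₂ + w₂) - v₂ * (q * v₁ + w₁) ≡ v₁ * w₂ - v₂ * w₁
    identity = solve-∀

  affine-origin : ∀ o v u → affine o v u (0ℤ , 0ℤ) ≡ o
  affine-origin (o₁ , o₂) (v₁ , v₂) (u₁ , u₂) = cong₂ _,_ (identity o₁ v₁ u₁) (identity o₂ v₂ u₂)
    where
    identity : ∀ o v u → o + (0ℤ * v + 0ℤ * u) ≡ o
    identity = solve-∀

  affine-first-axis : ∀ o v u x → affine o v u (x , 0ℤ) ≡ o ⊕ x ⊙ v
  affine-first-axis (o₁ , o₂) (v₁ , v₂) (u₁ , u₂) x =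
    cong₂ _,_ (identity o₁ v₁ u₁ x) (identity o₂ v₂ u₂ x)
    where
    identity : ∀ o v u x → o + (x * v + 0ℤ * u) ≡ o + x * v
    identity = solve-∀

  affine-split : ∀ o v u x y → affine o v u (x , y) ≡ affine o v u (x , 0ℤ) ⊕ y ⊙ u
  affine-split (o₁ , o₂) (v₁ , v₂) (u₁ , u₂) x y =
    cong₂ _,_ (identity o₁ v₁ u₁ x y) (identity o₂ v₂ u₂ x y)
    where
    identity : ∀ o v u x y → o + (x * v + y * u) ≡ o + (x * v + 0ℤ * u) + y * u
    identity = solve-∀

  -- Convexity of the grid

  <⇒0<- : ∀ {i j} → i < j → 0ℤ < j - i
  <⇒0<- {i} {j} i<j = subst (_< j - i) (+-inverseʳ i) (+-monoˡ-< (- i) i<j)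

  private
    <⇒-<0 : ∀ {i j} → i < j → i - j < 0ℤ
    <⇒-<0 {i} {j} i<j = subst (i - j <_) (+-inverseʳ j) (+-monoˡ-< (- j) i<j)

    0<-* : ∀ {i j} → 0ℤ < i → 0ℤ < j → 0ℤ < i * j
    0<-* {i} {j} 0<i 0<j = subst (_< i * j) (*-zeroʳ i) (*-monoˡ-<-pos i ⦃ positive 0<i ⦄ 0<j)

    *-<0 : ∀ {i j} → 0ℤ < i → j < 0ℤ → i * j < 0ℤ
    *-<0 {i} {j} 0<i j<0 = subst (i * j <_) (*-zeroʳ i) (*-monoˡ-<-pos i ⦃ positive 0<i ⦄ j<0)

  balanced-between : ∀ {A B C x y z s lo hi} → 0ℤ < A → 0ℤ < B → 0ℤ < C →
    A * (x - s) + B * (y - s) + C * (z - s) ≡ 0ℤ →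
    lo ≤ x × x ≤ hi → lo ≤ y × y ≤ hi → lo ≤ z × z ≤ hi → lo ≤ s × s ≤ hi
  balanced-between {s = s} {lo} {hi} 0<A 0<B 0<C balance (lo≤x , x≤hi) (lo≤y , y≤hi) (lo≤z , z≤hi) =
    lo≤s , s≤hi
    where
    lo≤s : lo ≤ s
    lo≤s with lo ≤? s
    ... | yes lo≤s = lo≤s
    ... | no  lo≰s = contradiction
      (+-mono-< (+-mono-< (0<-* 0<A (above lo≤x)) (0<-* 0<B (above lo≤y))) (0<-* 0<C (above lo≤z)))
      (<-irrefl (sym balance))
      where
      above : ∀ {t} → lo ≤ t → 0ℤ < t - s
      above lo≤t = <⇒0<- (<-≤-trans (≰⇒> lo≰s) lo≤t)
    s≤hi : s ≤ hi
    s≤hi with s ≤? hi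
    ... | yes s≤hi = s≤hi
    ... | no  s≰hi = contradiction
      (+-mono-< (+-mono-< (*-<0 0<A (below x≤hi)) (*-<0 0<B (below y≤hi))) (*-<0 0<C (below z≤hi)))
      (<-irrefl balance)
      where
      below : ∀ {t} → t ≤ hi → t - s < 0ℤ
      below t≤hi = <⇒-<0 (≤-<-trans t≤hi (≰⇒> s≰hi))

  -- Each coordinate of s is the mean of those of p, q, r weighted by orient s q r, orient s r p and
  -- orient s p q (cross-cyclic-sum), and these weights are positive.
  positive-interior-in-grid : ∀ {m p q r s} → InGrid m p → InGrid m q → InGrid m r →
    0ℤ < orient p q s × 0ℤ < orient q r s × 0ℤ < orient r p s → InGrid m s
  positive-interior-in-grid {p = p} {q} {r} {s} (p₁ , p₂) (q₁ , q₂) (r₁ , r₂) (0<pqs , 0<qrs , 0<rps) =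
    balanced-between 0<sqr 0<srp 0<spq (cong proj₁ balance) p₁ q₁ r₁ ,
    balanced-between 0<sqr 0<srp 0<spq (cong proj₂ balance) p₂ q₂ r₂
    where
    balance = cross-cyclic-sum (p ⊖ s) (q ⊖ s) (r ⊖ s)
    0<sqr : 0ℤ < orient s q r
    0<sqr = subst (0ℤ <_) (trans (orient-rotate q r s) (orient-rotate r s q)) 0<qrs
    0<srp : 0ℤ < orient s r p
    0<srp = subst (0ℤ <_) (trans (orient-rotate r p s) (orient-rotate p s r)) 0<rps
    0<spq : 0ℤ < orient s p q
    0<spq = subst (0ℤ <_) (trans (orient-rotate p q s) (orient-rotate q s p)) 0<pqs

  private
    reverse-positive : ∀ p q r s → 0ℤ < orient p q s × 0ℤ < orient q r s × 0ℤ < orient r p s →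
      orient q p s < 0ℤ × orient p r s < 0ℤ × orient r q s < 0ℤ
    reverse-positive p q r s (pqs , qrs , rps) =
      flip (orient-swap p q s) pqs , flip (orient-swap r p s) rps , flip (orient-swap q r s) qrs
      where
      flip : ∀ {i j} → j ≡ - i → 0ℤ < i → j < 0ℤ
      flip refl 0<i = neg-mono-< 0<i

    reverse-negative : ∀ p q r s → orient p q s < 0ℤ × orient q r s < 0ℤ × orient r p s < 0ℤ →
      0ℤ < orient q p s × 0ℤ < orient p r s × 0ℤ < orient r q s
    reverse-negative p q r s (pqs , qrs , rps) =
      flip (orient-swap p q s) pqs , flip (orient-swap r p s) rps , flip (orient-swap q r s) qrs
      where
      flip : ∀ {i j} → j ≡ - i → i < 0ℤ → 0ℤ < j
      flip refl i<0 = neg-mono-< i<0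

  InInterior-swap : ∀ {p q r s} → InInterior p q r s → InInterior q p r s
  InInterior-swap {p} {q} {r} {s} (inj₁ positive) = inj₂ (reverse-positive p q r s positive)
  InInterior-swap {p} {q} {r} {s} (inj₂ negative) = inj₁ (reverse-negative p q r s negative)

  InInterior⇒InGrid : ∀ {m p q r s} → InGrid m p → InGrid m q → InGrid m r → InInterior p q r s → InGrid m s
  InInterior⇒InGrid gp gq gr (inj₁ positive) = positive-interior-in-grid gp gq gr positive
  InInterior⇒InGrid {p = p} {q} {r} {s} gp gq gr (inj₂ negative) =
    positive-interior-in-grid gq gp gr (reverse-negative p q r s negative)

  data Axis : Set where
    first second : Axis

  component : Axis → Point → ℤ
  component first  = proj₁
  component second = proj₂

  component-⊖ : ∀ i a b → component i (a ⊖ b) ≡ component i a - component i b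
  component-⊖ first  a b = refl
  component-⊖ second a b = refl

  component-⊙ : ∀ i k a → component i (k ⊙ a) ≡ k * component i a
  component-⊙ first  k a = refl
  component-⊙ second k a = refl

  nonzero-component : ∀ v → v ≢ (0ℤ , 0ℤ) → ∃[ i ] component i v ≢ 0ℤ
  nonzero-component (v₁ , v₂) v≢0 with v₁ ≟ 0ℤ | v₂ ≟ 0ℤ
  ... | no v₁≢0  | _        = first , v₁≢0
  ... | yes _    | no v₂≢0  = second , v₂≢0
  ... | yes refl | yes refl = ⊥-elim (v≢0 refl)

  Determines : Point → Axis → Set
  Determines v i = ∀ {a b} → cross v a ≡ cross v b → component i a ≡ component i b → a ≡ b

  private
    -‿cancelʳ : ∀ {x y} c → x - c ≡ y - c → x ≡ y
    -‿cancelʳ {x} {y} c eq = trans (sym (identity x c)) (trans (cong (_+ c) eq) (identity y c))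
      where
      identity : ∀ x c → x - c + c ≡ x
      identity = solve-∀

    -‿cancelˡ : ∀ {x y} c → c - x ≡ c - y → x ≡ y
    -‿cancelˡ {x} {y} c eq = trans (sym (identity c x)) (trans (cong (_-_ c) eq) (identity c y))
      where
      identity : ∀ c x → c - (c - x) ≡ x
      identity = solve-∀

  determining-axis : ∀ v → v ≢ (0ℤ , 0ℤ) → ∃[ i ] Determines v i
  determining-axis v@(v₁ , v₂) v≢0 with nonzero-component v v≢0
  ... | first  , v₁≢0 = first , λ { {a₁ , a₂} {.a₁ , b₂} cross≡ refl →
    cong (a₁ ,_) (*-cancelˡ-≡ v₁ a₂ b₂ ⦃ ≢-nonZero v₁≢0 ⦄ (-‿cancelʳ (v₂ * a₁) cross≡)) }
  ... | second , v₂≢0 = second , λ { {a₁ , a₂} {b₁ , .a₂} cross≡ refl →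
    cong (_, a₂) (*-cancelˡ-≡ v₂ a₁ b₁ ⦃ ≢-nonZero v₂≢0 ⦄ (-‿cancelˡ (v₁ * a₂) cross≡)) }

  -- Primitive vectors

  ∣i∣≡sign*i : ∀ i → ∃[ σ ] + ∣ i ∣ ≡ σ * i
  ∣i∣≡sign*i (+ n)    = 1ℤ , sym (*-identityˡ (+ n))
  ∣i∣≡sign*i -[1+ n ] = -1ℤ , sym (-1*i≡-i -[1+ n ])

  private
    +-difference : ∀ {a b c} → c ℕ.+ b ≡ a → + a - + b ≡ + c
    +-difference {b = b} {c} refl = trans (cong (_- + b) (pos-+ c b)) (identity (+ c) (+ b))
      where
      identity : ∀ c b → (c + b) - b ≡ c
      identity = solve-∀

  bézout : ∀ i j → ∃₂ λ x y → x * i + y * j ≡ + gcd ∣ i ∣ ∣ j ∣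
  bézout i j with ∣i∣≡sign*i i | ∣i∣≡sign*i j | Bézout.identity (gcd-GCD ∣ i ∣ ∣ j ∣)
  ... | σ , ∣i∣≡σi | τ , ∣j∣≡τj | Bézout.+- x y eq = (+ x) * σ , - ((+ y) * τ) , (begin
    (+ x) * σ * i + - ((+ y) * τ) * j      ≡⟨ identity (+ x) (+ y) σ τ i j ⟩
    (+ x) * (σ * i) - (+ y) * (τ * j)      ≡⟨ cong₂ (λ a b → (+ x) * a - (+ y) * b) (sym ∣i∣≡σi) (sym ∣j∣≡τj) ⟩
    (+ x) * (+ ∣ i ∣) - (+ y) * (+ ∣ j ∣)  ≡⟨ cong₂ _-_ (sym (pos-* x ∣ i ∣)) (sym (pos-* y ∣ j ∣)) ⟩
    + (x ℕ.* ∣ i ∣) - + (y ℕ.* ∣ j ∣)      ≡⟨ +-difference eq ⟩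
    + gcd ∣ i ∣ ∣ j ∣                    ∎)
    where
    identity : ∀ x y σ τ i j → x * σ * i + - (y * τ) * j ≡ x * (σ * i) - y * (τ * j)
    identity = solve-∀
  ... | σ , ∣i∣≡σi | τ , ∣j∣≡τj | Bézout.-+ x y eq = - ((+ x) * σ) , (+ y) * τ , (begin
    - ((+ x) * σ) * i + (+ y) * τ * j      ≡⟨ identity (+ x) (+ y) σ τ i j ⟩
    (+ y) * (τ * j) - (+ x) * (σ * i)      ≡⟨ cong₂ (λ a b → (+ y) * b - (+ x) * a) (sym ∣i∣≡σi) (sym ∣j∣≡τj) ⟩
    (+ y) * (+ ∣ j ∣) - (+ x) * (+ ∣ i ∣)  ≡⟨ cong₂ _-_ (sym (pos-* y ∣ j ∣)) (sym (pos-* x ∣ i ∣)) ⟩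
    + (y ℕ.* ∣ j ∣) - + (x ℕ.* ∣ i ∣)      ≡⟨ +-difference eq ⟩
    + gcd ∣ i ∣ ∣ j ∣                    ∎)
    where
    identity : ∀ x y σ τ i j → - (x * σ) * i + y * τ * j ≡ y * (τ * j) - x * (σ * i)
    identity = solve-∀

  unimodular-complement : ∀ {G a b x y d₁ d₂} .⦃ _ : NonZero G ⦄ →
    d₁ ≡ a * G → d₂ ≡ b * G → x * d₁ + y * d₂ ≡ G → cross (a , b) (- y , x) ≡ 1ℤ
  unimodular-complement {G} {a} {b} {x} {y} refl refl combination =
    *-cancelʳ-≡ (cross (a , b) (- y , x)) 1ℤ G (begin
      (a * x - b * - y) * G      ≡⟨ identity G a b x y ⟩
      x * (a * G) + y * (b * G)  ≡⟨ combination ⟩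
      G                          ≡⟨ sym (*-identityˡ G) ⟩
      1ℤ * G                     ∎)
    where
    identity : ∀ G a b x y → (a * x - b * - y) * G ≡ x * (a * G) + y * (b * G)
    identity = solve-∀

  primitive-decomposition : ∀ d → d ≢ (0ℤ , 0ℤ) →
    ∃[ g ] ∃[ v ] ∃[ w ] d ≡ +[1+ g ] ⊙ v × cross v w ≡ 1ℤ
  primitive-decomposition (d₁ , d₂) d≢0
    with gcd ∣ d₁ ∣ ∣ d₂ ∣ in gcd≡
       | ∣ᵤ⇒∣ {+ gcd ∣ d₁ ∣ ∣ d₂ ∣} {d₁} (gcd[m,n]∣m ∣ d₁ ∣ ∣ d₂ ∣)
       | ∣ᵤ⇒∣ {+ gcd ∣ d₁ ∣ ∣ d₂ ∣} {d₂} (gcd[m,n]∣n ∣ d₁ ∣ ∣ d₂ ∣)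
       | bézout d₁ d₂
  ... | ℕ.zero | _ | _ | _ = ⊥-elim (d≢0 (cong₂ _,_
    (∣i∣≡0⇒i≡0 (gcd[m,n]≡0⇒m≡0 gcd≡)) (∣i∣≡0⇒i≡0 (gcd[m,n]≡0⇒n≡0 ∣ d₁ ∣ gcd≡))))
  ... | ℕ.suc g | divides a d₁≡ | divides b d₂≡ | x , y , combination =
    g , (a , b) , (- y , x) ,
    cong₂ _,_ (trans d₁≡ (*-comm a +[1+ g ])) (trans d₂≡ (*-comm b +[1+ g ])) ,
    unimodular-complement {a = a} {b} {x} {y} d₁≡ d₂≡ combination

module EmptyTriangles where

  open Counting
  open Hyperbola using (UnderHyperbola; UnderHyperbola-bounded; interval; ∈-interval)
  open Plane
  open import Data.Integer
    using (ℤ; +_; +[1+_]; 0ℤ; 1ℤ; _+_; _-_; _*_; ∣_∣; _<_; _≤_; +<+; +≤+; ≢-nonZero)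
  open import Data.Integer.Properties
    using (pos-*; *-zeroʳ; *-cancelˡ-<-nonNeg; abs-*; <-cmp; neg-mono-<; ∣m⊝n∣≤m⊔n; m-n≡m⊖n)
  open import Data.Integer.DivMod using (_/ℕ_; _%ℕ_; a≡a%ℕn+[a/ℕn]*n; n%ℕd<d)
  open import Data.Integer.Tactic.RingSolver using (solve-∀)
  open import Data.Nat as ℕ using (ℕ; zero; suc; z≤n; s≤s)
  import Data.Nat.Properties as ℕ
  import Data.Nat.Tactic.RingSolver as ℕ-Solver
  open import Data.Nat.Logarithm using (⌊log₂_⌋; ⌊log₂⌋-mono-≤)
  open import Data.Empty using (⊥-elim)
  open import Data.List using (List; map; length)
  open import Data.List.Properties using (length-map; length-applyUpTo)
  open import Data.List.Membership.Propositional using (_∈_)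
  open import Data.List.Membership.Propositional.Properties using (∈-map⁺)
  open import Data.Product using (∃-syntax; _×_; _,_)
  open import Data.Sum using (_⊎_; inj₁; inj₂)
  open import Function using (id; _∘_)
  open import Relation.Binary.Definitions using (tri<; tri≈; tri>)
  open import Relation.Binary.PropositionalEquality
  open import Relation.Nullary using (¬_)
  open ≡-Reasoning

  unit-point-interior : ∀ g t k → t ℕ.< k → 0 ℕ.< t ℕ.+ g →
    InInterior (0ℤ , 0ℤ) (+[1+ g ] , 0ℤ) (+[1+ t ] , +[1+ k ]) (1ℤ , 1ℤ)
  unit-point-interior g t k t<k 0<t+g = inj₁ (0<base , 0<middle , 0<apex)
    where
    base : ∀ G → (G - 0ℤ) * (1ℤ - 0ℤ) - (0ℤ - 0ℤ) * (1ℤ - 0ℤ) ≡ G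
    base = solve-∀
    middle : ∀ G T K → (T - G) * (1ℤ - 0ℤ) - (K - 0ℤ) * (1ℤ - G) ≡ (T - 1ℤ) + (G - 1ℤ) * (K - 1ℤ)
    middle = solve-∀
    apex : ∀ T K → (0ℤ - T) * (1ℤ - K) - (0ℤ - K) * (1ℤ - T) ≡ K - T
    apex = solve-∀
    0<t+g*k : ∀ t g k → t ℕ.< k → 0 ℕ.< t ℕ.+ g → 0 ℕ.< t ℕ.+ g ℕ.* k
    0<t+g*k (suc t) g       k       _ _ = s≤s z≤n
    0<t+g*k zero    (suc g) (suc k) _ _ = s≤s z≤n
    0<base : 0ℤ < orient (0ℤ , 0ℤ) (+[1+ g ] , 0ℤ) (1ℤ , 1ℤ)
    0<base = subst (0ℤ <_) (sym (base +[1+ g ])) (+<+ (s≤s z≤n))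
    -- +[1+ n ] - 1ℤ reduces to + n, so the middle orientation is t + g·k.
    0<middle : 0ℤ < orient (+[1+ g ] , 0ℤ) (+[1+ t ] , +[1+ k ]) (1ℤ , 1ℤ)
    0<middle = subst (0ℤ <_)
      (sym (trans (middle +[1+ g ] +[1+ t ] +[1+ k ]) (cong (λ x → + t + x) (sym (pos-* g k)))))
      (+<+ (0<t+g*k t g k t<k 0<t+g))
    0<apex : 0ℤ < orient (+[1+ t ] , +[1+ k ]) (0ℤ , 0ℤ) (1ℤ , 1ℤ)
    0<apex = subst (0ℤ <_) (sym (apex +[1+ t ] +[1+ k ])) (<⇒0<- (+<+ (s≤s t<k)))

  affine-triangle-nonempty : ∀ {m p q r} o v u g t k → cross v u ≡ 1ℤ → t ℕ.< k → 0 ℕ.< t ℕ.+ g →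
    p ≡ affine o v u (0ℤ , 0ℤ) → q ≡ affine o v u (+[1+ g ] , 0ℤ) → r ≡ affine o v u (+[1+ t ] , +[1+ k ]) →
    InGrid m p → InGrid m q → InGrid m r → ¬ InteriorEmpty m p q r
  affine-triangle-nonempty o v u g t k det t<k 0<t+g refl refl refl gp gq gr empty =
    empty (affine o v u (1ℤ , 1ℤ)) (InInterior⇒InGrid gp gq gr inside) inside
    where
    inside = InInterior-affine o v u (0ℤ , 0ℤ) (+[1+ g ] , 0ℤ) (+[1+ t ] , +[1+ k ]) (1ℤ , 1ℤ) det
               (unit-point-interior g t k t<k 0<t+g)

  -- The base pq is (g + 1)·v; the apex lies over p, or over q when pq is v itself.
  empty-affine-triangle-apex : ∀ {m p q r} o v u g t k → cross v u ≡ 1ℤ → t ℕ.< suc k →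
    p ≡ affine o v u (0ℤ , 0ℤ) → q ≡ affine o v u (+[1+ g ] , 0ℤ) → r ≡ affine o v u (+ t , +[1+ k ]) →
    InGrid m p → InGrid m q → InGrid m r → InteriorEmpty m p q r → t ≡ 0 ⊎ (t ≡ 1 × g ≡ 0)
  empty-affine-triangle-apex o v u g       zero          k _ _ _ _ _ _ _ _ _ = inj₁ refl
  empty-affine-triangle-apex o v u zero    (suc zero)    k _ _ _ _ _ _ _ _ _ = inj₂ (refl , refl)
  empty-affine-triangle-apex o v u (suc g) (suc zero)    k det (s≤s t<k) p≡ q≡ r≡ gp gq gr empty =
    ⊥-elim (affine-triangle-nonempty o v u (suc g) 0 k det t<k (s≤s z≤n) p≡ q≡ r≡ gp gq gr empty)
  empty-affine-triangle-apex o v u g       (suc (suc t)) k det (s≤s t<k) p≡ q≡ r≡ gp gq gr empty =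
    ⊥-elim (affine-triangle-nonempty o v u g (suc t) k det t<k (s≤s z≤n) p≡ q≡ r≡ gp gq gr empty)

  positive⇒+[1+] : ∀ {i} → 0ℤ < i → ∃[ n ] i ≡ +[1+ n ]
  positive⇒+[1+] {+[1+ n ]} _        = n , refl
  positive⇒+[1+] {+ zero}   (+<+ ())

  empty-triangle-apex : ∀ {m p q r v w} g → cross v w ≡ 1ℤ → q ≡ p ⊕ +[1+ g ] ⊙ v →
    InGrid m p → InGrid m q → InGrid m r → InteriorEmpty m p q r → 0ℤ < orient p q r →
    ∃[ k ] ∃[ u ] cross v u ≡ 1ℤ × (r ≡ p ⊕ +[1+ k ] ⊙ u ⊎ r ≡ q ⊕ +[1+ k ] ⊙ u)
  empty-triangle-apex {m} {p} {q} {r} {v} {w} g det q≡ gp gq gr empty 0<pqr = apex (positive⇒+[1+] 0<height)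
    where
    0<height : 0ℤ < cross v (r ⊖ p)
    0<height = *-cancelˡ-<-nonNeg +[1+ g ]
      (subst₂ _<_ (sym (*-zeroʳ +[1+ g ])) (orient-from-base +[1+ g ] v r q≡) 0<pqr)
    apex : ∃[ k ] cross v (r ⊖ p) ≡ +[1+ k ] →
      ∃[ k ] ∃[ u ] cross v u ≡ 1ℤ × (r ≡ p ⊕ +[1+ k ] ⊙ u ⊎ r ≡ q ⊕ +[1+ k ] ⊙ u)
    apex (k , height≡) = k , u , det′ , conclude
      (empty-affine-triangle-apex p v u g t k det′ (n%ℕd<d X (suc k)) p-frame q-frame r-frame gp gq gr empty)
      where
      X = cross (r ⊖ p) w
      t = X %ℕ suc k
      Q = X /ℕ suc k
      u = Q ⊙ v ⊕ w
      det′ : cross v u ≡ 1ℤ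
      det′ = trans (cross-shear Q v w) det
      remainder : X - Q * cross v (r ⊖ p) ≡ + t
      remainder = begin
        X - Q * cross v (r ⊖ p)            ≡⟨ cong (λ y → X - Q * y) height≡ ⟩
        X - Q * +[1+ k ]                   ≡⟨ cong (_- Q * +[1+ k ]) (a≡a%ℕn+[a/ℕn]*n X (suc k)) ⟩
        + t + Q * +[1+ k ] - Q * +[1+ k ]  ≡⟨ identity (+ t) (Q * +[1+ k ]) ⟩
        + t                                ∎
        where
        identity : ∀ a b → a + b - b ≡ a
        identity = solve-∀
      p-frame : p ≡ affine p v u (0ℤ , 0ℤ)
      p-frame = sym (affine-origin p v u)
      q-frame : q ≡ affine p v u (+[1+ g ] , 0ℤ)
      q-frame = trans q≡ (sym (affine-first-axis p v u +[1+ g ]))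
      r-frame : r ≡ affine p v u (+ t , +[1+ k ])
      r-frame = begin
        r                                                         ≡⟨ sym (affine-coordinates p v w r det) ⟩
        affine p v w (X , cross v (r ⊖ p))                        ≡⟨ affine-shear p v w Q X (cross v (r ⊖ p)) ⟩
        affine p v u (X - Q * cross v (r ⊖ p) , cross v (r ⊖ p))
          ≡⟨ cong (affine p v u) (cong₂ _,_ remainder height≡) ⟩
        affine p v u (+ t , +[1+ k ])                             ∎
      from-frame : ∀ x {b} → r ≡ affine p v u (x , +[1+ k ]) → affine p v u (x , 0ℤ) ≡ b → r ≡ b ⊕ +[1+ k ] ⊙ u
      from-frame x r≡ b≡ = trans r≡ (trans (affine-split p v u x +[1+ k ]) (cong (_⊕ +[1+ k ] ⊙ u) b≡))
      conclude : t ≡ 0 ⊎ (t ≡ 1 × g ≡ 0) → r ≡ p ⊕ +[1+ k ] ⊙ u ⊎ r ≡ q ⊕ +[1+ k ] ⊙ u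
      conclude (inj₁ t≡0) =
        inj₁ (from-frame 0ℤ (trans r-frame (cong (λ t → affine p v u (+ t , +[1+ k ])) t≡0)) (affine-origin p v u))
      conclude (inj₂ (t≡1 , g≡0)) =
        inj₂ (from-frame 1ℤ (trans r-frame (cong (λ t → affine p v u (+ t , +[1+ k ])) t≡1))
                            (trans (cong (λ g → affine p v u (+[1+ g ] , 0ℤ)) (sym g≡0)) (sym q-frame)))

  InGrid-component : ∀ {m a} → InGrid m a → ∀ i → + 1 ≤ component i a × component i a ≤ + m
  InGrid-component (bounds , _) first  = bounds
  InGrid-component (_ , bounds) second = bounds

  interval-gap : ∀ {m x y} → + 1 ≤ x × x ≤ + m → + 1 ≤ y × y ≤ + m → ∣ x - y ∣ ℕ.≤ m
  interval-gap {x = + a} {y = + b} (_ , +≤+ a≤m) (_ , +≤+ b≤m) =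
    subst (ℕ._≤ _) (cong ∣_∣ (sym (m-n≡m⊖n a b))) (ℕ.≤-trans (∣m⊝n∣≤m⊔n a b) (ℕ.⊔-lub a≤m b≤m))

  grid-gap : ∀ {m a b} → InGrid m a → InGrid m b → ∀ i → ∣ component i (a ⊖ b) ∣ ℕ.≤ m
  grid-gap {a = a} {b} ga gb i = subst (ℕ._≤ _) (cong ∣_∣ (sym (component-⊖ i a b)))
    (interval-gap (InGrid-component ga i) (InGrid-component gb i))

  ApexKey : Point → Axis → Point → Point → ℕ × ℤ → Set
  ApexKey v i b r (k , c) = ∃[ u ] cross v u ≡ 1ℤ × component i u ≡ c × r ≡ b ⊕ + k ⊙ u

  ApexKey-injective : ∀ v i b → Determines v i → ∀ r r′ key → ApexKey v i b r key → ApexKey v i b r′ key → r ≡ r′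
  ApexKey-injective v i b determines _ _ (k , _) (u , det , refl , refl) (u′ , det′ , c≡ , refl) =
    cong (λ u → b ⊕ + k ⊙ u) (determines (trans det (sym det′)) (sym c≡))

  ApexKey-under-hyperbola : ∀ {m b r} k u i → InGrid m b → InGrid m r → u ≢ (0ℤ , 0ℤ) →
    r ≡ b ⊕ +[1+ k ] ⊙ u → UnderHyperbola m (suc k , component i u)
  ApexKey-under-hyperbola {m} {b} k u i gb gr u≢0 refl = s≤s z≤n , k<m , step-bound i
    where
    step-bound : ∀ j → suc k ℕ.* ∣ component j u ∣ ℕ.≤ m
    step-bound j = subst (ℕ._≤ m) (begin
      ∣ component j ((b ⊕ +[1+ k ] ⊙ u) ⊖ b) ∣  ≡⟨ cong (λ d → ∣ component j d ∣) (⊕-⊖-cancel b (+[1+ k ] ⊙ u)) ⟩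
      ∣ component j (+[1+ k ] ⊙ u) ∣            ≡⟨ cong ∣_∣ (component-⊙ j +[1+ k ] u) ⟩
      ∣ +[1+ k ] * component j u ∣              ≡⟨ abs-* +[1+ k ] (component j u) ⟩
      suc k ℕ.* ∣ component j u ∣               ∎) (grid-gap gr gb j)
    k<m : suc k ℕ.≤ m
    k<m with nonzero-component u u≢0
    ... | j , uⱼ≢0 = ℕ.≤-trans (ℕ.m≤m*n (suc k) ∣ component j u ∣ ⦃ ≢-nonZero uⱼ≢0 ⦄) (step-bound j)

  EmptyLeft : ℕ → Point → Point → Point → Set
  EmptyLeft m p q r = InGrid m r × InteriorEmpty m p q r × 0ℤ < orient p q r

  EmptyLeft-bounded : ∀ {m p q} → 2 ℕ.≤ m → InGrid m p → InGrid m q → p ≢ q →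
    Bounded (EmptyLeft m p q) (⌊log₂ (m ℕ.* m) ⌋ ℕ.* (3 ℕ.* m) ℕ.+ ⌊log₂ (m ℕ.* m) ⌋ ℕ.* (3 ℕ.* m))
  EmptyLeft-bounded {m} {p} {q} 2≤m gp gq p≢q with primitive-decomposition (q ⊖ p) (⊖-≢0 p≢q)
  ... | g , v , w , q⊖p≡ , det with determining-axis v (unimodular⇒≢0ˡ {v} {w} det)
  ... | i , determines = Bounded-mono (λ {r} → classify {r}) ℕ.≤-refl (Bounded-∪ (apexes p) (apexes q))
    where
    Apex : Point → Point → Set
    Apex b r = ∃[ key ] ApexKey v i b r key × UnderHyperbola m key
    apexes : ∀ b → Bounded (Apex b) (⌊log₂ (m ℕ.* m) ⌋ ℕ.* (3 ℕ.* m))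
    apexes b =
      Bounded-by-keys (ApexKey v i b) (ApexKey-injective v i b determines) (UnderHyperbola-bounded m 2≤m) id
    q≡ : q ≡ p ⊕ +[1+ g ] ⊙ v
    q≡ = trans (sym (⊖-⊕-cancel p q)) (cong (p ⊕_) q⊖p≡)
    classify : ∀ {r} → EmptyLeft m p q r → Apex p r ⊎ Apex q r
    classify (gr , empty , 0<pqr) = apex-key gr (empty-triangle-apex {v = v} {w} g det q≡ gp gq gr empty 0<pqr)
      where
      apex-key : ∀ {r} → InGrid m r →
        ∃[ k ] ∃[ u ] cross v u ≡ 1ℤ × (r ≡ p ⊕ +[1+ k ] ⊙ u ⊎ r ≡ q ⊕ +[1+ k ] ⊙ u) → Apex p r ⊎ Apex q r
      apex-key gr (k , u , det′ , inj₁ r≡) = inj₁ ((suc k , component i u) , (u , det′ , refl , r≡) ,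
                                                  ApexKey-under-hyperbola k u i gp gr (unimodular⇒≢0ʳ {v} det′) r≡)
      apex-key gr (k , u , det′ , inj₂ r≡) = inj₂ ((suc k , component i u) , (u , det′ , refl , r≡) ,
                                                  ApexKey-under-hyperbola k u i gq gr (unimodular⇒≢0ʳ {v} det′) r≡)

  Collinear : ℕ → Point → Point → Point → Set
  Collinear m p q r = InGrid m r × orient p q r ≡ 0ℤ

  Collinear-bounded : ∀ {m p q} → p ≢ q → Bounded (Collinear m p q) m
  Collinear-bounded {m} {p} {q} p≢q with determining-axis (q ⊖ p) (⊖-≢0 p≢q)
  ... | i , determines = Bounded-by-keys Key Key-injective
    (Bounded-mono id (ℕ.≤-reflexive length-line) (Bounded-∈ line)) keyOf
    where
    line : List ℤ
    line = map +_ (interval 1 m)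
    length-line : length line ≡ m
    length-line = trans (length-map +_ (interval 1 m)) (length-applyUpTo (1 ℕ.+_) m)
    ∈-line : ∀ {x} → + 1 ≤ x × x ≤ + m → x ∈ line
    ∈-line {+ a} (+≤+ 1≤a , +≤+ a≤m) = ∈-map⁺ +_ (∈-interval 1≤a (s≤s a≤m))
    Key : Point → ℤ → Set
    Key r c = orient p q r ≡ 0ℤ × component i r ≡ c
    Key-injective : ∀ r r′ c → Key r c → Key r′ c → r ≡ r′
    Key-injective r r′ _ (pqr≡0 , refl) (pqr′≡0 , c≡) = ⊖-injectiveˡ p (determines (trans pqr≡0 (sym pqr′≡0))
      (trans (component-⊖ i r p) (trans (cong (_- component i p) (sym c≡)) (sym (component-⊖ i r′ p)))))
    keyOf : ∀ {r} → Collinear m p q r → ∃[ c ] Key r c × c ∈ line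
    keyOf {r} (gr , pqr≡0) = component i r , (pqr≡0 , refl) , ∈-line (InGrid-component gr i)

  empty-triangles-bounded : ∀ {m p q} → 2 ℕ.≤ m → InGrid m p → InGrid m q → p ≢ q →
    Bounded (λ r → InGrid m r × InteriorEmpty m p q r) (13 ℕ.* m ℕ.* ⌊log₂ (m ℕ.* m) ⌋)
  empty-triangles-bounded {m} {p} {q} 2≤m gp gq p≢q = Bounded-mono classify size
    (Bounded-∪ (Collinear-bounded p≢q)
               (Bounded-∪ (EmptyLeft-bounded 2≤m gp gq p≢q) (EmptyLeft-bounded 2≤m gq gp (p≢q ∘ sym))))
    where
    classify : ∀ {r} → InGrid m r × InteriorEmpty m p q r →
      Collinear m p q r ⊎ (EmptyLeft m p q r ⊎ EmptyLeft m q p r)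
    classify {r} (gr , empty) with <-cmp (orient p q r) 0ℤ
    ... | tri< pqr<0 _ _ = inj₂ (inj₂ (gr , (λ s gs → empty s gs ∘ InInterior-swap {q} {p} {r} {s}) ,
                                       subst (0ℤ <_) (sym (orient-swap p q r)) (neg-mono-< pqr<0)))
    ... | tri≈ _ pqr≡0 _ = inj₁ (gr , pqr≡0)
    ... | tri> _ _ 0<pqr = inj₂ (inj₁ (gr , empty , 0<pqr))
    L = ⌊log₂ (m ℕ.* m) ⌋
    size : m ℕ.+ ((L ℕ.* (3 ℕ.* m) ℕ.+ L ℕ.* (3 ℕ.* m)) ℕ.+ (L ℕ.* (3 ℕ.* m) ℕ.+ L ℕ.* (3 ℕ.* m)))
           ℕ.≤ 13 ℕ.* m ℕ.* L
    size = ℕ.≤-trans (ℕ.+-monoˡ-≤ _ m≤m*L) (ℕ.≤-reflexive (identity m L))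
      where
      1≤L : 1 ℕ.≤ L
      1≤L = ⌊log₂⌋-mono-≤ {2} (ℕ.≤-trans 2≤m (ℕ.m≤m*n m m ⦃ ℕ.>-nonZero (ℕ.≤-trans (s≤s z≤n) 2≤m) ⦄))
      m≤m*L : m ℕ.≤ m ℕ.* L
      m≤m*L = subst (ℕ._≤ m ℕ.* L) (ℕ.*-identityʳ m) (ℕ.*-monoʳ-≤ m 1≤L)
      identity : ∀ m L →
        m ℕ.* L ℕ.+ ((L ℕ.* (3 ℕ.* m) ℕ.+ L ℕ.* (3 ℕ.* m)) ℕ.+ (L ℕ.* (3 ℕ.* m) ℕ.+ L ℕ.* (3 ℕ.* m)))
          ≡ 13 ℕ.* m ℕ.* L
      identity = ℕ-Solver.solve-∀

open import Data.Nat using (ℕ; _≤_; _*_)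
open import Data.Nat.Logarithm using (⌊log₂_⌋)
open import Data.Product using (_×_; ∃-syntax; _,_)
open import Data.List using (List; length)
open import Data.List.Relation.Unary.All using (All)
open import Data.List.Relation.Unary.Unique.Propositional using (Unique)
open import Relation.Binary.PropositionalEquality using (_≢_)
open EmptyTriangles using (empty-triangles-bounded)

lemma1 : ∃[ C ] ∃[ N ] ∀ (m : ℕ) → N ≤ m →
    ∀ (p q : Point) → InGrid m p → InGrid m q → p ≢ q →
    ∀ (rs : List Point) → Unique rs →
    All (λ r → InGrid m r × InteriorEmpty m p q r) rs →
    length rs ≤ C * m * ⌊log₂ (m * m)⌋
lemma1 = 13 , 2 , λ m 2≤m p q gp gq p≢q → empty-triangles-bounded 2≤m gp gq p≢q
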